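{- Let $k\ge2$ and $r\ge 2$ be integers and let $q=\frac{r^k-1}{r-1}$. Every $k$-uniform hypergraph $G$ with $m$ edges contains a subhypergraph with at least $\frac{1}{2\,k!}m^{(q-1)/q}$ edges which contains no copy of $K^{(k)}_{r,\ldots,r}$.
   Context: $K^{(k)}_{r,\ldots,r}$ denotes the complete $k$-partite $k$-uniform hypergraph with $k$ parts each of order $r$ (its edges are all $k$-sets containing exactly one vertex from each part). -}

module Defs where

open import Data.Nat using (ℕ; zero; suc; _+_; _*_; _^_)
open import Data.Fin using (Fin)
open import Data.Fin.Subset using (Subset; _∈_; ∣_∣)
open import Data.List using (List)
open import Data.List.Membership.Propositional renaming (_∈_ to _∈ₗ_)
open import Data.List.Relation.Unary.All using (All)
open import Data.List.Relation.Unary.Unique.Propositional using (Unique)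
open import Data.Product using (Σ; ∃; ∃-syntax; _×_)
open import Relation.Binary.PropositionalEquality using (_≡_)
open import Relation.Nullary using (¬_)

-- A hypergraph on vertex set Fin n: a duplicate-free list of edges,
-- each edge a subset of the vertex set.
-- G is k-uniform: every edge has exactly k vertices.
Uniform : ∀ {n} → ℕ → List (Subset n) → Set
Uniform k G = All (λ e → ∣ e ∣ ≡ k) G

SubEdges : ∀ {n} → List (Subset n) → List (Subset n) → Set
SubEdges H G = ∀ {e} → e ∈ₗ H → e ∈ₗ G

-- A copy of K^{(k)}_{r,...,r} in H: an injective embedding φ of the vertex set
-- (part i, position a) of K into Fin n such that every edge of K
-- (a choice g of one vertex from each part) is mapped onto an edge of H.
KCopy : ∀ {n} → ℕ → ℕ → List (Subset n) → Set
KCopy {n} k r H =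
  Σ (Fin k → Fin r → Fin n) λ φ →
    (∀ i j a b → φ i a ≡ φ j b → (i ≡ j) × (a ≡ b)) ×
    (∀ (g : Fin k → Fin r) →
       ∃[ e ] (e ∈ₗ H × (∀ x → (x ∈ e → ∃[ i ] φ i (g i) ≡ x)
                              × (∃[ i ] φ i (g i) ≡ x → x ∈ e))))

KFree : ∀ {n} → ℕ → ℕ → List (Subset n) → Set
KFree k r H = ¬ KCopy k r H

-- geometric sum 1 + r + ... + r^(k-1) = (r^k - 1)/(r - 1)  (for r ≥ 2)
geom : ℕ → ℕ → ℕ
geom zero    r = 0
geom (suc k) r = r ^ k + geom k r

-- The alteration method, derandomised by averaging. Keep every edge of G independently
-- with probability p = y / (k! m), where y is the least integer with m^(q-1) ≤ y^q; in
-- place of probabilities a set c of edges gets the weight y^|c| (k! m - y)^(m - |c|).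
-- A copy of K = K^(k)_(r,...,r) is pinned down by its r diagonal edges together with
-- r - 1 permutations of k vertices, so there are at most m^r (k!)^(r-1) candidate copies,
-- each with r^k = 1 + q (r - 1) edges. Some c therefore has at least
-- p m - m^r (k!)^(r-1) p^(r^k) more edges than fully kept candidates, and deleting one
-- edge of each of those leaves a K-free subgraph; the choice of y makes this at least
-- y / (2 k!). When fewer than r^k edges are wanted, any that many edges will do.

module Submission where

open import Defs
open import Data.Nat using (ℕ; _*_; _^_; _≤_; _∸_; _!)
open import Data.Fin.Subset using (Subset)
open import Data.List using (List; length)
open import Data.List.Relation.Unary.Unique.Propositional using (Unique)
open import Data.Product using (∃-syntax; _×_)

open import Data.Nat.Properties
open import Algebra.Properties.CommutativeSemigroup *-commutativeSemigroup
  using (x∙yz≈y∙xz; x∙yz≈xz∙y; xy∙z≈xz∙y; xy∙z≈x∙zy)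
open import Algebra.Properties.Semiring.Sum +-*-semiring using (sum; sum-syntax; *-distribˡ-sum; *-distribʳ-sum)
open import Data.Bool using (Bool; true; false; _∧_)
import Data.Bool as Bool
open import Data.Fin
  using (Fin; zero; suc; cast; punchIn; punchOut; quotient; remainder; remQuot; combine; finToFun; funToFin)
open import Data.Fin.Properties
  using (injective⇒≤; cast-involutive; remQuot-combine; punchIn-punchOut; punchOut-injective;
         funToFin-finToFin; finToFun-funToFin; any?)
  renaming (suc-injective to fsuc-injective)
open import Data.Fin.Subset using (inside; outside; _∈_; _⊆_; ∣_∣; ⁅_⁆; _∪_; ⊥)
open import Data.Fin.Subset.Properties
  using (drop-∷-⊆; _⊆?_; ∉⊥; x∈⁅x⁆; x∈⁅y⁆⇒x≡y; x∈p∪q⁻; x∈p∪q⁺; ⊆-antisym)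
open import Data.List using ([]; _∷_; map; lookup)
open import Data.List.Properties using (length-map)
open import Data.List.Membership.Propositional renaming (_∈_ to _∈ₗ_)
open import Data.List.Membership.Propositional.Properties using (∈-map⁺; ∈-map⁻; ∈-lookup)
open import Data.List.Membership.Setoid.Properties using (index-injective)
import Data.List.Relation.Unary.All as All
import Data.List.Relation.Unary.Any as Any
open import Data.List.Relation.Unary.Any.Properties using (lookup-index)
open import Data.List.Relation.Unary.AllPairs using ([]; _∷_)
import Data.List.Relation.Unary.Unique.Propositional.Properties as Unique
open import Data.Nat using (zero; suc; _+_; _<_; z≤n; s≤s; _≤?_; _<?_; >-nonZero)
open import Data.Nat.Tactic.RingSolver using (solve-∀)
open import Data.Product using (_,_; proj₁; proj₂)
open import Data.Sum using (_⊎_; inj₁; inj₂)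
open import Data.Vec using ([]; _∷_; here; there; tabulate)
open import Data.Vec.Properties using (≡-dec; []=⇒lookup; lookup⇒[]=; lookup∘tabulate)
open import Function using (_∘_; id)
open import Function.Definitions using (Injective)
open import Relation.Binary.PropositionalEquality
open import Relation.Nullary using (¬_; Dec; yes; no; does; contradiction)
open import Relation.Nullary.Decidable using (dec-true)
open import Relation.Unary using (Decidable)

-- Finite subsets

elements : ∀ {n} → Subset n → List (Fin n)
elements []            = []
elements (inside ∷ p)  = zero ∷ map suc (elements p)
elements (outside ∷ p) = map suc (elements p)

∈⇒∈-elements : ∀ {n} (p : Subset n) {x} → x ∈ p → x ∈ₗ elements p
∈⇒∈-elements (inside ∷ p)  here      = Any.here refl
∈⇒∈-elements (inside ∷ p)  (there x) = Any.there (∈-map⁺ suc (∈⇒∈-elements p x))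
∈⇒∈-elements (outside ∷ p) (there x) = ∈-map⁺ suc (∈⇒∈-elements p x)

∈-elements⇒∈ : ∀ {n} (p : Subset n) {x} → x ∈ₗ elements p → x ∈ p
∈-elements⇒∈ (inside ∷ p) (Any.here refl) = here
∈-elements⇒∈ (inside ∷ p) (Any.there x) with ∈-map⁻ suc x
... | y , y∈ , refl = there (∈-elements⇒∈ p y∈)
∈-elements⇒∈ (outside ∷ p) x with ∈-map⁻ suc x
... | y , y∈ , refl = there (∈-elements⇒∈ p y∈)

length-elements : ∀ {n} (p : Subset n) → length (elements p) ≡ ∣ p ∣
length-elements []            = refl
length-elements (inside ∷ p)  = cong suc (trans (length-map suc (elements p)) (length-elements p))
length-elements (outside ∷ p) = trans (length-map suc (elements p)) (length-elements p)

elements-unique : ∀ {n} (p : Subset n) → Unique (elements p)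
elements-unique []            = []
elements-unique (inside ∷ p)  = All.tabulate zero∉ ∷ Unique.map⁺ fsuc-injective (elements-unique p)
  where
  zero∉ : ∀ {x} → x ∈ₗ map suc (elements p) → zero ≢ x
  zero∉ x∈ with ∈-map⁻ suc x∈
  ... | _ , _ , refl = λ ()
elements-unique (outside ∷ p) = Unique.map⁺ fsuc-injective (elements-unique p)

lookup-injective : ∀ {A : Set} {xs : List A} → Unique xs → Injective _≡_ _≡_ (lookup xs)
lookup-injective {xs = _ ∷ xs} (x∉ ∷ u) {zero}  {zero}  _  = refl
lookup-injective {xs = _ ∷ xs} (x∉ ∷ u) {zero}  {suc j} eq = contradiction eq (All.lookup x∉ (∈-lookup j))
lookup-injective {xs = _ ∷ xs} (x∉ ∷ u) {suc i} {zero}  eq = contradiction (sym eq) (All.lookup x∉ (∈-lookup i))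
lookup-injective {xs = _ ∷ xs} (x∉ ∷ u) {suc i} {suc j} eq = cong suc (lookup-injective u eq)

injective⇒≤∣∣ : ∀ {t n} (p : Subset n) (f : Fin t → Fin n) →
                Injective _≡_ _≡_ f → (∀ i → f i ∈ p) → t ≤ ∣ p ∣
injective⇒≤∣∣ p f f-inj f∈p =
  subst (_ ≤_) (length-elements p) (injective⇒≤ {f = position} position-injective)
  where
  position : _ → Fin (length (elements p))
  position i = Any.index (∈⇒∈-elements p (f∈p i))
  position-injective : Injective _≡_ _≡_ position
  position-injective eq = f-inj (index-injective (setoid _) (∈⇒∈-elements p _) (∈⇒∈-elements p _) eq)

module _ {n k : ℕ} (e : Subset n) (∣e∣≡k : ∣ e ∣ ≡ k) where

  private
    k≡length : k ≡ length (elements e)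
    k≡length = sym (trans (length-elements e) ∣e∣≡k)

  vertex : Fin k → Fin n
  vertex a = lookup (elements e) (cast k≡length a)

  vertex-∈ : ∀ a → vertex a ∈ e
  vertex-∈ a = ∈-elements⇒∈ e (∈-lookup (cast k≡length a))

  vertex-injective : Injective _≡_ _≡_ vertex
  vertex-injective {a} {b} eq = begin
    a                                ≡⟨ cast-involutive (sym k≡length) k≡length a ⟨
    cast (sym k≡length) (cast _ a)   ≡⟨ cong (cast (sym k≡length)) (lookup-injective (elements-unique e) eq) ⟩
    cast (sym k≡length) (cast _ b)   ≡⟨ cast-involutive (sym k≡length) k≡length b ⟩
    b                                ∎
    where open ≡-Reasoning

  vertex-surjective : ∀ {x} → x ∈ e → ∃[ a ] vertex a ≡ x
  vertex-surjective x∈e = cast (sym k≡length) (Any.index x∈) , (begin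
    lookup (elements e) (cast k≡length (cast (sym k≡length) (Any.index x∈)))
      ≡⟨ cong (lookup (elements e)) (cast-involutive k≡length (sym k≡length) (Any.index x∈)) ⟩
    lookup (elements e) (Any.index x∈)  ≡⟨ lookup-index x∈ ⟨
    _ ∎)
    where
    open ≡-Reasoning
    x∈ = ∈⇒∈-elements e x∈e

subset-of-size : ∀ m K → K ≤ m → ∃[ D ] ∣_∣ {m} D ≡ K
subset-of-size zero    zero    _         = [] , refl
subset-of-size (suc m) zero    _         =
  outside ∷ proj₁ (subset-of-size m 0 z≤n) , proj₂ (subset-of-size m 0 z≤n)
subset-of-size (suc m) (suc K) (s≤s K≤m) =
  inside ∷ proj₁ (subset-of-size m K K≤m) , cong suc (proj₂ (subset-of-size m K K≤m))

satisfying : ∀ {n} {P : Fin n → Set} → Decidable P → Subset n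
satisfying P? = tabulate (does ∘ P?)

∈-satisfying⁺ : ∀ {n} {P : Fin n → Set} (P? : Decidable P) {x} → P x → x ∈ satisfying P?
∈-satisfying⁺ {P = P} P? {x} px = lookup⇒[]= x _ (trans (lookup∘tabulate (does ∘ P?) x) (does-yes (P? x)))
  where
  does-yes : (d : Dec (P x)) → does d ≡ true
  does-yes (yes _) = refl
  does-yes (no ¬p) = contradiction px ¬p

∈-satisfying⁻ : ∀ {n} {P : Fin n → Set} (P? : Decidable P) {x} → x ∈ satisfying P? → P x
∈-satisfying⁻ P? {x} x∈ with P? x | trans (sym (lookup∘tabulate (does ∘ P?) x)) ([]=⇒lookup x∈)
... | yes px | _ = px

image : ∀ {k n} → (Fin k → Fin n) → Subset n
image {zero}  f = ⊥
image {suc k} f = ⁅ f zero ⁆ ∪ image (f ∘ suc)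

∈-image⁺ : ∀ {k n} (f : Fin k → Fin n) a → f a ∈ image f
∈-image⁺ {suc k} f zero    = x∈p∪q⁺ (inj₁ (x∈⁅x⁆ (f zero)))
∈-image⁺ {suc k} f (suc a) = x∈p∪q⁺ {p = ⁅ f zero ⁆} (inj₂ (∈-image⁺ (f ∘ suc) a))

∈-image⁻ : ∀ {k n} (f : Fin k → Fin n) {x} → x ∈ image f → ∃[ a ] f a ≡ x
∈-image⁻ {zero}  f x∈ = contradiction x∈ ∉⊥
∈-image⁻ {suc k} f x∈ with x∈p∪q⁻ ⁅ f zero ⁆ (image (f ∘ suc)) x∈
... | inj₁ x∈⁅f0⁆ = zero , sym (x∈⁅y⁆⇒x≡y (f zero) x∈⁅f0⁆)
... | inj₂ x∈rest = let a , fa≡x = ∈-image⁻ (f ∘ suc) x∈rest in suc a , fa≡x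

image-≡ : ∀ {k l n} (f : Fin k → Fin n) (g : Fin l → Fin n) →
          (∀ a → ∃[ b ] g b ≡ f a) → (∀ b → ∃[ a ] f a ≡ g b) → image f ≡ image g
image-≡ f g f⊆g g⊆f = ⊆-antisym (covered f g f⊆g) (covered g f g⊆f)
  where
  covered : ∀ {k l} (f : Fin k → Fin _) (g : Fin l → Fin _) → (∀ a → ∃[ b ] g b ≡ f a) →
            ∀ {x} → x ∈ image f → x ∈ image g
  covered f g f⊆g x∈ =
    let a , fa≡x = ∈-image⁻ f x∈ ; b , gb≡fa = f⊆g a in
    subst (_∈ image g) (trans gb≡fa fa≡x) (∈-image⁺ g b)

image-cong : ∀ {k n} {f g : Fin k → Fin n} → (∀ a → f a ≡ g a) → image f ≡ image g
image-cong {f = f} {g} f≗g = image-≡ f g (λ a → a , sym (f≗g a)) (λ a → a , f≗g a)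

-- Coding permutations and functions by numbers

decodePerm : ∀ k → Fin (k !) → Fin k → Fin k
decodePerm (suc k) c zero    = quotient (k !) c
decodePerm (suc k) c (suc a) = punchIn (quotient (k !) c) (decodePerm k (remainder {suc k} (k !) c) a)

-- An injection σ is coded by σ 0 followed by the code of σ with σ 0 punched out.
decodePerm-surjective : ∀ k (σ : Fin k → Fin k) → Injective _≡_ _≡_ σ →
                        ∃[ c ] ∀ a → decodePerm k c a ≡ σ a
decodePerm-surjective zero    σ σ-inj = zero , λ ()
decodePerm-surjective (suc k) σ σ-inj = combine (σ zero) c′ , decode
  where
  σ0≢ : ∀ a → σ zero ≢ σ (suc a)
  σ0≢ a eq with σ-inj eq
  ... | ()
  σ′ : Fin k → Fin k
  σ′ a = punchOut (σ0≢ a)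
  σ′-inj : Injective _≡_ _≡_ σ′
  σ′-inj {a} {b} eq with σ-inj (punchOut-injective (σ0≢ a) (σ0≢ b) eq)
  ... | refl = refl
  c′ : Fin (k !)
  c′ = proj₁ (decodePerm-surjective k σ′ σ′-inj)
  split : remQuot {suc k} (k !) (combine (σ zero) c′) ≡ (σ zero , c′)
  split = remQuot-combine (σ zero) c′
  decode : ∀ a → decodePerm (suc k) (combine (σ zero) c′) a ≡ σ a
  decode zero    = cong proj₁ split
  decode (suc a) = begin
    punchIn (quotient (k !) _) (decodePerm k (remainder {suc k} (k !) _) a)
      ≡⟨ cong₂ (λ p c → punchIn p (decodePerm k c a)) (cong proj₁ split) (cong proj₂ split) ⟩
    punchIn (σ zero) (decodePerm k c′ a)
      ≡⟨ cong (punchIn (σ zero)) (proj₂ (decodePerm-surjective k σ′ σ′-inj) a) ⟩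
    punchIn (σ zero) (σ′ a)              ≡⟨ punchIn-punchOut (σ0≢ a) ⟩
    σ (suc a)                            ∎
    where open ≡-Reasoning

funToFin-cong : ∀ {a b} (f g : Fin a → Fin b) → (∀ x → f x ≡ g x) → funToFin f ≡ funToFin g
funToFin-cong {zero}  f g f≗g = refl
funToFin-cong {suc a} f g f≗g = cong₂ combine (f≗g zero) (funToFin-cong (f ∘ suc) (g ∘ suc) (f≗g ∘ suc))

finToFun-injective : ∀ {a b} {u v : Fin (b ^ a)} →
                     (∀ x → finToFun {b} {a} u x ≡ finToFun {b} {a} v x) → u ≡ v
finToFun-injective {a} {b} {u} {v} u≗v = begin
  u                             ≡⟨ funToFin-finToFin {a} {b} u ⟨
  funToFin (finToFun {b} {a} u) ≡⟨ funToFin-cong (finToFun {b} {a} u) (finToFun v) u≗v ⟩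
  funToFin (finToFun {b} {a} v) ≡⟨ funToFin-finToFin {a} {b} v ⟩
  v                             ∎
  where open ≡-Reasoning

-- Weighted sums over all subsets

indicator : Bool → ℕ
indicator true  = 1
indicator false = 0

sumSubsets : ∀ m → (Subset m → ℕ) → ℕ
sumSubsets zero    f = f []
sumSubsets (suc m) f = sumSubsets m (f ∘ (outside ∷_)) + sumSubsets m (f ∘ (inside ∷_))

sumSubsets-mono-≤ : ∀ m {f g : Subset m → ℕ} → (∀ c → f c ≤ g c) → sumSubsets m f ≤ sumSubsets m g
sumSubsets-mono-≤ zero    f≤g = f≤g []
sumSubsets-mono-≤ (suc m) f≤g = +-mono-≤ (sumSubsets-mono-≤ m (f≤g ∘ _)) (sumSubsets-mono-≤ m (f≤g ∘ _))

sumSubsets-cong : ∀ m {f g : Subset m → ℕ} → (∀ c → f c ≡ g c) → sumSubsets m f ≡ sumSubsets m g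
sumSubsets-cong m f≡g = ≤-antisym (sumSubsets-mono-≤ m (≤-reflexive ∘ f≡g)) (sumSubsets-mono-≤ m (≤-reflexive ∘ sym ∘ f≡g))

sumSubsets-distrib-+ : ∀ m (f g : Subset m → ℕ) →
                       sumSubsets m (λ c → f c + g c) ≡ sumSubsets m f + sumSubsets m g
sumSubsets-distrib-+ zero    f g = refl
sumSubsets-distrib-+ (suc m) f g
  rewrite sumSubsets-distrib-+ m (f ∘ (outside ∷_)) (g ∘ (outside ∷_))
        | sumSubsets-distrib-+ m (f ∘ (inside ∷_)) (g ∘ (inside ∷_)) =
  [a+b]+[c+d]≡[a+c]+[b+d] (sumSubsets m (f ∘ (outside ∷_))) (sumSubsets m (g ∘ (outside ∷_)))
                          (sumSubsets m (f ∘ (inside ∷_))) (sumSubsets m (g ∘ (inside ∷_)))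
  where
  [a+b]+[c+d]≡[a+c]+[b+d] : ∀ a b c d → a + b + (c + d) ≡ a + c + (b + d)
  [a+b]+[c+d]≡[a+c]+[b+d] = solve-∀

sumSubsets-*ˡ : ∀ m k (f : Subset m → ℕ) → sumSubsets m (λ c → k * f c) ≡ k * sumSubsets m f
sumSubsets-*ˡ zero    k f = refl
sumSubsets-*ˡ (suc m) k f
  rewrite sumSubsets-*ˡ m k (f ∘ (outside ∷_)) | sumSubsets-*ˡ m k (f ∘ (inside ∷_)) =
  sym (*-distribˡ-+ k _ _)

sumSubsets-∑ : ∀ m N (h : Fin N → Subset m → ℕ) →
               sumSubsets m (λ c → ∑[ i < N ] h i c) ≡ ∑[ i < N ] sumSubsets m (h i)
sumSubsets-∑ m zero    h = sumSubsets-*ˡ m 0 (λ _ → 0)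
sumSubsets-∑ m (suc N) h =
  trans (sumSubsets-distrib-+ m (h zero) _) (cong (sumSubsets m (h zero) +_) (sumSubsets-∑ m N (h ∘ suc)))

sumSubsets-<⇒∃< : ∀ m {f g : Subset m → ℕ} → sumSubsets m f < sumSubsets m g → ∃[ c ] f c < g c
sumSubsets-<⇒∃< zero f<g = [] , f<g
sumSubsets-<⇒∃< (suc m) {f} {g} f<g
  with sumSubsets m (f ∘ (outside ∷_)) <? sumSubsets m (g ∘ (outside ∷_))
... | yes lt = let c , lt′ = sumSubsets-<⇒∃< m lt in outside ∷ c , lt′
... | no ≮ = let c , lt′ = sumSubsets-<⇒∃< m (+-cancelˡ-< _ _ _ (<-≤-trans f<g (+-monoˡ-≤ _ (≮⇒≥ ≮)))) in
  inside ∷ c , lt′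

∑≤*-const : ∀ N {f : Fin N → ℕ} B → (∀ i → f i ≤ B) → ∑[ i < N ] f i ≤ N * B
∑≤*-const zero    B f≤B = z≤n
∑≤*-const (suc N) B f≤B = +-mono-≤ (f≤B zero) (∑≤*-const N B (f≤B ∘ suc))

module _ (a z : ℕ) where

  -- a ^ ∣ c ∣ * z ^ (m ∸ ∣ c ∣): the probability of c, times (a + z) ^ m, when each element
  -- is kept independently with probability a / (a + z).
  weight : ∀ {m} → Subset m → ℕ
  weight []            = 1
  weight (inside ∷ c)  = a * weight c
  weight (outside ∷ c) = z * weight c

  sumSubsets-weight-suc : ∀ m (f : Subset (suc m) → ℕ) →
    sumSubsets (suc m) (λ c → weight c * f c) ≡
      z * sumSubsets m (λ c → weight c * f (outside ∷ c)) + a * sumSubsets m (λ c → weight c * f (inside ∷ c))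
  sumSubsets-weight-suc m f = cong₂ _+_
    (trans (sumSubsets-cong m (λ c → *-assoc z (weight c) _)) (sumSubsets-*ˡ m z _))
    (trans (sumSubsets-cong m (λ c → *-assoc a (weight c) _)) (sumSubsets-*ˡ m a _))

  sum-weight : ∀ m → sumSubsets m weight ≡ (a + z) ^ m
  sum-weight zero    = refl
  sum-weight (suc m) = begin
    sumSubsets m (λ c → z * weight c) + sumSubsets m (λ c → a * weight c)
      ≡⟨ cong₂ _+_ (sumSubsets-*ˡ m z weight) (sumSubsets-*ˡ m a weight) ⟩
    z * sumSubsets m weight + a * sumSubsets m weight ≡⟨ cong (λ s → z * s + a * s) (sum-weight m) ⟩
    z * (a + z) ^ m + a * (a + z) ^ m                 ≡⟨ factor a z ((a + z) ^ m) ⟩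
    (a + z) ^ suc m                                   ∎
    where
    open ≡-Reasoning
    factor : ∀ a z p → z * p + a * p ≡ (a + z) * p
    factor = solve-∀

  sum-weight-∣∣ : ∀ m → sumSubsets m (λ c → weight c * ∣ c ∣) * (a + z) ≡ a * m * (a + z) ^ m
  sum-weight-∣∣ zero    = cong (_* 1) (sym (*-zeroʳ a))
  sum-weight-∣∣ (suc m) = begin
    sumSubsets (suc m) (λ c → weight c * ∣ c ∣) * (a + z)
      ≡⟨ cong (_* (a + z)) (sumSubsets-weight-suc m ∣_∣) ⟩
    (z * S + a * sumSubsets m (λ c → weight c * suc ∣ c ∣)) * (a + z)
      ≡⟨ cong (λ s → (z * S + a * s) * (a + z)) (sumSubsets-cong m (λ c → *-suc (weight c) ∣ c ∣)) ⟩
    (z * S + a * sumSubsets m (λ c → weight c + weight c * ∣ c ∣)) * (a + z)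
      ≡⟨ cong (λ s → (z * S + a * s) * (a + z)) (sumSubsets-distrib-+ m weight (λ c → weight c * ∣ c ∣)) ⟩
    (z * S + a * (sumSubsets m weight + S)) * (a + z)
      ≡⟨ cong (λ s → (z * S + a * (s + S)) * (a + z)) (sum-weight m) ⟩
    (z * S + a * (P + S)) * (a + z)        ≡⟨ regroup a z S P ⟩
    S * (a + z) * (a + z) + a * P * (a + z) ≡⟨ cong (λ s → s * (a + z) + a * P * (a + z)) (sum-weight-∣∣ m) ⟩
    a * m * P * (a + z) + a * P * (a + z)  ≡⟨ collect a z m P ⟩
    a * suc m * (a + z) ^ suc m            ∎
    where
    open ≡-Reasoning
    S = sumSubsets m (λ c → weight c * ∣ c ∣)
    P = (a + z) ^ m
    regroup : ∀ a z S P → (z * S + a * (P + S)) * (a + z) ≡ S * (a + z) * (a + z) + a * P * (a + z)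
    regroup = solve-∀
    collect : ∀ a z m P → a * m * P * (a + z) + a * P * (a + z) ≡ a * suc m * ((a + z) * P)
    collect = solve-∀

  sum-weight-⊇ : ∀ {m} (b : Subset m) →
    sumSubsets m (λ c → weight c * indicator (does (b ⊆? c))) * (a + z) ^ ∣ b ∣ ≡ a ^ ∣ b ∣ * (a + z) ^ m
  sum-weight-⊇ {zero}  [] = refl
  sum-weight-⊇ {suc m} (inside ∷ b) = begin
    sumSubsets (suc m) (λ c → weight c * indicator (does (inside ∷ b ⊆? c))) * ((a + z) * Q)
      ≡⟨ cong (_* ((a + z) * Q)) (sumSubsets-weight-suc m (λ c → indicator (does (inside ∷ b ⊆? c)))) ⟩
    (z * sumSubsets m (λ c → weight c * 0) + a * T) * ((a + z) * Q)
      ≡⟨ cong (λ s → (z * s + a * T) * ((a + z) * Q))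
              (trans (sumSubsets-cong m (λ c → *-zeroʳ (weight c))) (sumSubsets-*ˡ m 0 (λ _ → 0))) ⟩
    (z * 0 + a * T) * ((a + z) * Q)       ≡⟨ regroup a z T Q ⟩
    a * (a + z) * (T * Q)                 ≡⟨ cong (a * (a + z) *_) (sum-weight-⊇ b) ⟩
    a * (a + z) * (a ^ ∣ b ∣ * (a + z) ^ m) ≡⟨ regroup′ a (a + z) (a ^ ∣ b ∣) ((a + z) ^ m) ⟩
    a ^ suc ∣ b ∣ * (a + z) ^ suc m       ∎
    where
    open ≡-Reasoning
    T = sumSubsets m (λ c → weight c * indicator (does (b ⊆? c)))
    Q = (a + z) ^ ∣ b ∣
    regroup : ∀ a z T Q → (z * 0 + a * T) * ((a + z) * Q) ≡ a * (a + z) * (T * Q)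
    regroup = solve-∀
    regroup′ : ∀ a M A P → a * M * (A * P) ≡ (a * A) * (M * P)
    regroup′ = solve-∀
  sum-weight-⊇ {suc m} (outside ∷ b) = begin
    sumSubsets (suc m) (λ c → weight c * indicator (does (outside ∷ b ⊆? c))) * Q
      ≡⟨ cong (_* Q) (sumSubsets-weight-suc m (λ c → indicator (does (outside ∷ b ⊆? c)))) ⟩
    (z * T + a * T) * Q                   ≡⟨ regroup a z T Q ⟩
    (a + z) * (T * Q)                     ≡⟨ cong ((a + z) *_) (sum-weight-⊇ b) ⟩
    (a + z) * (a ^ ∣ b ∣ * (a + z) ^ m)   ≡⟨ x∙yz≈y∙xz (a + z) (a ^ ∣ b ∣) ((a + z) ^ m) ⟩
    a ^ ∣ b ∣ * (a + z) ^ suc m           ∎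
    where
    open ≡-Reasoning
    T = sumSubsets m (λ c → weight c * indicator (does (b ⊆? c)))
    Q = (a + z) ^ ∣ b ∣
    regroup : ∀ a z T Q → (z * T + a * T) * Q ≡ (a + z) * (T * Q)
    regroup = solve-∀

  sum-weight-⊇-≤ : ∀ {m} (b : Subset m) t → 0 < a + z → t ≤ ∣ b ∣ →
    sumSubsets m (λ c → weight c * indicator (does (b ⊆? c))) * (a + z) ^ t ≤ a ^ t * (a + z) ^ m
  sum-weight-⊇-≤ {m} b t a+z>0 t≤∣b∣ = *-cancelʳ-≤ _ _ (M ^ d) {{>-nonZero (m^n>0 M d)}} (begin
    T * M ^ t * M ^ d     ≡⟨ *-assoc T (M ^ t) (M ^ d) ⟩
    T * (M ^ t * M ^ d)   ≡⟨ cong (T *_) (sym (^-distribˡ-+-* M t d)) ⟩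
    T * M ^ (t + d)       ≡⟨ cong (λ e → T * M ^ e) t+d≡∣b∣ ⟩
    T * M ^ ∣ b ∣          ≡⟨ sum-weight-⊇ b ⟩
    a ^ ∣ b ∣ * M ^ m      ≡⟨ cong (λ e → a ^ e * M ^ m) (sym t+d≡∣b∣) ⟩
    a ^ (t + d) * M ^ m   ≡⟨ cong (_* M ^ m) (^-distribˡ-+-* a t d) ⟩
    a ^ t * a ^ d * M ^ m ≤⟨ *-monoˡ-≤ (M ^ m) (*-monoʳ-≤ (a ^ t) (^-monoˡ-≤ d (m≤m+n a z))) ⟩
    a ^ t * M ^ d * M ^ m ≡⟨ swap (a ^ t) (M ^ d) (M ^ m) ⟩
    a ^ t * M ^ m * M ^ d ∎)
    where
    open ≤-Reasoning
    instance _ = >-nonZero a+z>0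
    M = a + z
    T = sumSubsets m (λ c → weight c * indicator (does (b ⊆? c)))
    d = ∣ b ∣ ∸ t
    t+d≡∣b∣ : t + d ≡ ∣ b ∣
    t+d≡∣b∣ = m+[n∸m]≡n t≤∣b∣
    swap : ∀ A B C → A * B * C ≡ A * C * B
    swap = solve-∀

  first-moment : ∀ m K t B (f : Subset m → ℕ) → 0 < a + z →
    sumSubsets m (λ c → weight c * f c) * (a + z) ^ t ≤ B * (a + z) ^ m →
    K * ((a + z) ^ t * (a + z)) + B * (a + z) ≤ a * m * (a + z) ^ t →
    ∃[ c ] K + f c ≤ ∣ c ∣
  first-moment m K t B f a+z>0 f-small K-small =
    let c , lt = sumSubsets-<⇒∃< m (*-cancelʳ-< _ _ _ S₁X<S₂X) in
    c , ≤-pred (*-cancelˡ-< (weight c) _ _ lt)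
    where
    M = a + z
    X = M ^ t * M
    S₁ = sumSubsets m (λ c → weight c * (K + f c))
    S₂ = sumSubsets m (λ c → weight c * suc ∣ c ∣)
    Sf = sumSubsets m (λ c → weight c * f c)
    Sc = sumSubsets m (λ c → weight c * ∣ c ∣)
    S₁≡ : S₁ ≡ K * M ^ m + Sf
    S₁≡ = begin
      S₁                                              ≡⟨ sumSubsets-cong m (λ c → *-distribˡ-+ (weight c) K (f c)) ⟩
      sumSubsets m (λ c → weight c * K + weight c * f c) ≡⟨ sumSubsets-distrib-+ m _ _ ⟩
      sumSubsets m (λ c → weight c * K) + Sf          ≡⟨ cong (_+ Sf) (sumSubsets-cong m (λ c → *-comm (weight c) K)) ⟩
      sumSubsets m (λ c → K * weight c) + Sf          ≡⟨ cong (_+ Sf) (sumSubsets-*ˡ m K weight) ⟩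
      K * sumSubsets m weight + Sf                    ≡⟨ cong (λ s → K * s + Sf) (sum-weight m) ⟩
      K * M ^ m + Sf                                  ∎
      where open ≡-Reasoning
    S₂≡ : S₂ ≡ M ^ m + Sc
    S₂≡ = begin
      S₂                                         ≡⟨ sumSubsets-cong m (λ c → *-suc (weight c) ∣ c ∣) ⟩
      sumSubsets m (λ c → weight c + weight c * ∣ c ∣) ≡⟨ sumSubsets-distrib-+ m weight _ ⟩
      sumSubsets m weight + Sc                   ≡⟨ cong (_+ Sc) (sum-weight m) ⟩
      M ^ m + Sc                                 ∎
      where open ≡-Reasoning
    S₁X<S₂X : S₁ * X < S₂ * X
    S₁X<S₂X = begin-strict
      S₁ * X                              ≡⟨ cong (_* X) S₁≡ ⟩
      (K * M ^ m + Sf) * X                ≡⟨ expand K (M ^ m) Sf (M ^ t) M ⟩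
      K * X * M ^ m + Sf * M ^ t * M      ≤⟨ +-monoʳ-≤ (K * X * M ^ m) (*-monoˡ-≤ M f-small) ⟩
      K * X * M ^ m + B * M ^ m * M       ≡⟨ collect (K * X) (M ^ m) B M ⟩
      (K * X + B * M) * M ^ m             ≤⟨ *-monoˡ-≤ (M ^ m) K-small ⟩
      a * m * M ^ t * M ^ m               <⟨ m<n+m _ (*-mono-< (*-mono-< (m^n>0 M m) (m^n>0 M t)) a+z>0) ⟩
      M ^ m * M ^ t * M + a * m * M ^ t * M ^ m ≡⟨ reorder (M ^ m) (M ^ t) M (a * m) ⟩
      M ^ m * X + a * m * M ^ m * M ^ t   ≡⟨ cong (λ s → M ^ m * X + s * M ^ t) (sum-weight-∣∣ m) ⟨
      M ^ m * X + Sc * M * M ^ t          ≡⟨ factor (M ^ m) (M ^ t) M Sc ⟩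
      (M ^ m + Sc) * X                    ≡⟨ cong (_* X) S₂≡ ⟨
      S₂ * X                              ∎
      where
      open ≤-Reasoning
      instance _ = >-nonZero a+z>0
      expand : ∀ K P S T M → (K * P + S) * (T * M) ≡ K * (T * M) * P + S * T * M
      expand = solve-∀
      collect : ∀ A P B M → A * P + B * P * M ≡ (A + B * M) * P
      collect = solve-∀
      reorder : ∀ P T M A → P * T * M + A * T * P ≡ P * (T * M) + A * P * T
      reorder = solve-∀
      factor : ∀ P T M S → P * (T * M) + S * M * T ≡ (P + S) * (T * M)
      factor = solve-∀

-- Alteration

removeLeastOf : ∀ {m} → Subset m → Subset m → Subset m
removeLeastOf []            []      = []
removeLeastOf (inside ∷ b)  (_ ∷ c) = outside ∷ c
removeLeastOf (outside ∷ b) (s ∷ c) = s ∷ removeLeastOf b c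

removeLeastOf-⊆ : ∀ {m} (b c : Subset m) → removeLeastOf b c ⊆ c
removeLeastOf-⊆ (inside ∷ b)  (_ ∷ c) (there x∈) = there x∈
removeLeastOf-⊆ (outside ∷ b) (s ∷ c) here       = here
removeLeastOf-⊆ (outside ∷ b) (s ∷ c) (there x∈) = there (removeLeastOf-⊆ b c x∈)

∣c∣≤1+∣removeLeastOf∣ : ∀ {m} (b c : Subset m) → ∣ c ∣ ≤ suc ∣ removeLeastOf b c ∣
∣c∣≤1+∣removeLeastOf∣ []            []            = z≤n
∣c∣≤1+∣removeLeastOf∣ (inside ∷ b)  (inside ∷ c)  = ≤-refl
∣c∣≤1+∣removeLeastOf∣ (inside ∷ b)  (outside ∷ c) = n≤1+n _
∣c∣≤1+∣removeLeastOf∣ (outside ∷ b) (inside ∷ c)  = s≤s (∣c∣≤1+∣removeLeastOf∣ b c)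
∣c∣≤1+∣removeLeastOf∣ (outside ∷ b) (outside ∷ c) = ∣c∣≤1+∣removeLeastOf∣ b c

removeLeastOf-⊈ : ∀ {m} (b c : Subset m) → 1 ≤ ∣ b ∣ → ¬ (b ⊆ removeLeastOf b c)
removeLeastOf-⊈ (inside ∷ b)  (_ ∷ c) _   b⊆ with b⊆ here
... | ()
removeLeastOf-⊈ (outside ∷ b) (s ∷ c) 1≤∣b∣ b⊆ = removeLeastOf-⊈ b c 1≤∣b∣ (drop-∷-⊆ b⊆)

removeLeastOfIf : ∀ {m} → Bool → Subset m → Subset m → Subset m
removeLeastOfIf true  b c = removeLeastOf b c
removeLeastOfIf false b c = c

removeLeastOfIf-⊆ : ∀ {m} β (b c : Subset m) → removeLeastOfIf β b c ⊆ c
removeLeastOfIf-⊆ true  b c = removeLeastOf-⊆ b c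
removeLeastOfIf-⊆ false b c = id

∣c∣≤∣removeLeastOfIf∣+1 : ∀ {m} β (b c : Subset m) → ∣ c ∣ ≤ ∣ removeLeastOfIf β b c ∣ + indicator β
∣c∣≤∣removeLeastOfIf∣+1 true  b c = subst (∣ c ∣ ≤_) (+-comm 1 _) (∣c∣≤1+∣removeLeastOf∣ b c)
∣c∣≤∣removeLeastOfIf∣+1 false b c = ≤-reflexive (sym (+-identityʳ _))

removeLeastOfEach : ∀ {m N} → (Fin N → Bool) → (Fin N → Subset m) → Subset m → Subset m
removeLeastOfEach {N = zero}  β b c = c
removeLeastOfEach {N = suc N} β b c = removeLeastOfIf (β zero) (b zero) (removeLeastOfEach (β ∘ suc) (b ∘ suc) c)

removeLeastOfEach-⊆ : ∀ {m N} β (b : Fin N → Subset m) c → removeLeastOfEach β b c ⊆ c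
removeLeastOfEach-⊆ {N = zero}  β b c = id
removeLeastOfEach-⊆ {N = suc N} β b c = removeLeastOfEach-⊆ (β ∘ suc) (b ∘ suc) c ∘ removeLeastOfIf-⊆ (β zero) (b zero) _

∣c∣≤∣removeLeastOfEach∣+∑ : ∀ {m N} β (b : Fin N → Subset m) c →
                ∣ c ∣ ≤ ∣ removeLeastOfEach β b c ∣ + ∑[ i < N ] indicator (β i)
∣c∣≤∣removeLeastOfEach∣+∑ {N = zero}  β b c = ≤-reflexive (sym (+-identityʳ _))
∣c∣≤∣removeLeastOfEach∣+∑ {N = suc N} β b c = begin
  ∣ c ∣                                      ≤⟨ ∣c∣≤∣removeLeastOfEach∣+∑ (β ∘ suc) (b ∘ suc) c ⟩
  ∣ c′ ∣ + rest                              ≤⟨ +-monoˡ-≤ rest (∣c∣≤∣removeLeastOfIf∣+1 (β zero) (b zero) c′) ⟩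
  ∣ removeLeastOfIf (β zero) (b zero) c′ ∣ + indicator (β zero) + rest ≡⟨ +-assoc _ (indicator (β zero)) rest ⟩
  ∣ removeLeastOfIf (β zero) (b zero) c′ ∣ + (indicator (β zero) + rest) ∎
  where
  open ≤-Reasoning
  c′ = removeLeastOfEach (β ∘ suc) (b ∘ suc) c
  rest = ∑[ i < N ] indicator (β (suc i))

removeLeastOfEach-⊈ : ∀ {m N} β (b : Fin N → Subset m) c i → β i ≡ true → 1 ≤ ∣ b i ∣ → ¬ (b i ⊆ removeLeastOfEach β b c)
removeLeastOfEach-⊈ {N = suc N} β b c zero    βi 1≤∣b∣ rewrite βi = removeLeastOf-⊈ (b zero) _ 1≤∣b∣
removeLeastOfEach-⊈ {N = suc N} β b c (suc i) βi 1≤∣b∣ b⊆ =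
  removeLeastOfEach-⊈ (β ∘ suc) (b ∘ suc) c i βi 1≤∣b∣ (removeLeastOfIf-⊆ (β zero) (b zero) _ ∘ b⊆)

module _ {m N : ℕ} (t : ℕ) (b : Fin N → Subset m) where

  isBad : Subset m → Fin N → Bool
  isBad c i = does (t ≤? ∣ b i ∣) ∧ does (b i ⊆? c)

  badCount : Subset m → ℕ
  badCount c = ∑[ i < N ] indicator (isBad c i)

AlterationBound : (a z m N t K : ℕ) → Set
AlterationBound a z m N t K = K * ((a + z) ^ t * (a + z)) + N * a ^ t * (a + z) ≤ a * m * (a + z) ^ t

module _ (a z : ℕ) {m N : ℕ} (t : ℕ) (b : Fin N → Subset m) (a+z>0 : 0 < a + z) where

  private
    sum-weight-isBad : ∀ i (large? : Dec (t ≤ ∣ b i ∣)) →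
      sumSubsets m (λ c → weight a z c * indicator (does large? ∧ does (b i ⊆? c))) * (a + z) ^ t ≤ a ^ t * (a + z) ^ m
    sum-weight-isBad i (yes t≤∣b∣) = sum-weight-⊇-≤ a z (b i) t a+z>0 t≤∣b∣
    sum-weight-isBad i (no _) = ≤-trans (≤-reflexive (cong (_* (a + z) ^ t)
      (trans (sumSubsets-cong m (λ c → *-zeroʳ (weight a z c))) (sumSubsets-*ˡ m 0 (λ _ → 0))))) z≤n

  sum-weight-badCount : sumSubsets m (λ c → weight a z c * badCount t b c) * (a + z) ^ t ≤ N * a ^ t * (a + z) ^ m
  sum-weight-badCount = begin
    sumSubsets m (λ c → weight a z c * badCount t b c) * M ^ t
      ≡⟨ cong (_* M ^ t) (sumSubsets-cong m (λ c → *-distribˡ-sum {N} (weight a z c) _)) ⟩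
    sumSubsets m (λ c → ∑[ i < N ] (weight a z c * indicator (isBad t b c i))) * M ^ t
      ≡⟨ cong (_* M ^ t) (sumSubsets-∑ m N _) ⟩
    (∑[ i < N ] sumSubsets m (λ c → weight a z c * indicator (isBad t b c i))) * M ^ t
      ≡⟨ *-distribʳ-sum {N} (M ^ t) _ ⟩
    ∑[ i < N ] (sumSubsets m (λ c → weight a z c * indicator (isBad t b c i)) * M ^ t)
      ≤⟨ ∑≤*-const N (a ^ t * M ^ m) (λ i → sum-weight-isBad i (t ≤? ∣ b i ∣)) ⟩
    N * (a ^ t * M ^ m) ≡⟨ *-assoc N _ _ ⟨
    N * a ^ t * M ^ m   ∎
    where
    open ≤-Reasoning
    M = a + z

  alteration : ∀ K → 1 ≤ t →
    AlterationBound a z m N t K →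
    ∃[ D ] (K ≤ ∣ D ∣ × ∀ i → t ≤ ∣ b i ∣ → ¬ (b i ⊆ D))
  alteration K 1≤t K-small = D , K≤∣D∣ , D-avoids
    where
    c,K+bad≤∣c∣ : ∃[ c ] K + badCount t b c ≤ ∣ c ∣
    c,K+bad≤∣c∣ = first-moment a z m K t (N * a ^ t) (badCount t b) a+z>0 sum-weight-badCount K-small
    c = proj₁ c,K+bad≤∣c∣
    D = removeLeastOfEach (isBad t b c) b c
    K≤∣D∣ : K ≤ ∣ D ∣
    K≤∣D∣ = +-cancelʳ-≤ (badCount t b c) K ∣ D ∣
              (≤-trans (proj₂ c,K+bad≤∣c∣) (∣c∣≤∣removeLeastOfEach∣+∑ (isBad t b c) b c))
    D-avoids : ∀ i → t ≤ ∣ b i ∣ → ¬ (b i ⊆ D)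
    D-avoids i t≤∣b∣ b⊆D = removeLeastOfEach-⊈ (isBad t b c) b c i bad (≤-trans 1≤t t≤∣b∣) b⊆D
      where
      bad : isBad t b c i ≡ true
      bad = cong₂ _∧_ (dec-true (t ≤? ∣ b i ∣) t≤∣b∣)
                      (dec-true (b i ⊆? c) (removeLeastOfEach-⊆ (isBad t b c) b c ∘ b⊆D))

-- Candidate copies of K^(k)_(r,...,r)

module Hypergraph {n : ℕ} (k r′ : ℕ) (G : List (Subset n)) (G-unique : Unique G) (G-uniform : Uniform k G) where

  r = suc r′
  m = length G

  edge : Fin m → Subset n
  edge = lookup G

  ∣edge∣ : ∀ p → ∣ edge p ∣ ≡ k
  ∣edge∣ p = All.lookup G-uniform (∈-lookup p)

  subgraph : Subset m → List (Subset n)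
  subgraph D = map edge (elements D)

  subgraph-unique : ∀ D → Unique (subgraph D)
  subgraph-unique D = Unique.map⁺ (lookup-injective G-unique) (elements-unique D)

  length-subgraph : ∀ D → length (subgraph D) ≡ ∣ D ∣
  length-subgraph D = trans (length-map edge (elements D)) (length-elements D)

  subgraph-⊆ : ∀ D → SubEdges (subgraph D) G
  subgraph-⊆ D e∈ with ∈-map⁻ edge e∈
  ... | p , _ , refl = ∈-lookup p

  ∈-subgraph⁻ : ∀ {D e} → e ∈ₗ subgraph D → ∃[ p ] (p ∈ D × edge p ≡ e)
  ∈-subgraph⁻ {D} e∈ with ∈-map⁻ edge e∈
  ... | p , p∈ , refl = p , ∈-elements⇒∈ D p∈ , refl

  -- A copy φ is determined, up to relabelling its parts, by its diagonal edges
  -- d j = {φ i j | i} and, for j ≥ 1, the permutation matching the vertex order of d j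
  -- with that of d 0; hence m ^ r * (k !) ^ r′ candidates suffice.
  candidates : ℕ
  candidates = m ^ r * (k !) ^ r′

  diagonal : Fin candidates → Fin r → Fin m
  diagonal i = finToFun (quotient ((k !) ^ r′) i)

  matching : Fin candidates → Fin r′ → Fin (k !)
  matching i = finToFun (remainder {m ^ r} ((k !) ^ r′) i)

  candidate-surjective : ∀ (d : Fin r → Fin m) (s : Fin r′ → Fin (k !)) →
    ∃[ i ] ((∀ j → diagonal i j ≡ d j) × (∀ j → matching i j ≡ s j))
  candidate-surjective d s = combine (funToFin d) (funToFin s) ,
    (λ j → trans (cong (λ u → finToFun u j) (cong proj₁ split)) (finToFun-funToFin d j)) ,
    (λ j → trans (cong (λ u → finToFun u j) (cong proj₂ split)) (finToFun-funToFin s j))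
    where split = remQuot-combine {m ^ r} {(k !) ^ r′} (funToFin d) (funToFin s)

  candidateVertex : Fin candidates → Fin k → Fin r → Fin n
  candidateVertex i a zero    = vertex (edge (diagonal i zero)) (∣edge∣ _) a
  candidateVertex i a (suc j) =
    vertex (edge (diagonal i (suc j))) (∣edge∣ _) (decodePerm k (matching i j) a)

  IsCandidateEdge : Fin candidates → Fin m → Set
  IsCandidateEdge i p = ∃[ u ] edge p ≡ image (λ a → candidateVertex i a (finToFun {r} {k} u a))

  isCandidateEdge? : ∀ i → Decidable (IsCandidateEdge i)
  isCandidateEdge? i p =
    any? (λ u → ≡-dec Bool._≟_ (edge p) (image (λ a → candidateVertex i a (finToFun u a))))

  candidateEdges : Fin candidates → Subset m
  candidateEdges i = satisfying (isCandidateEdge? i)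

  ∈-candidateEdges⁺ : ∀ {i p} → IsCandidateEdge i p → p ∈ candidateEdges i
  ∈-candidateEdges⁺ {i} = ∈-satisfying⁺ (isCandidateEdge? i)

  ∈-candidateEdges⁻ : ∀ {i p} → p ∈ candidateEdges i → IsCandidateEdge i p
  ∈-candidateEdges⁻ {i} = ∈-satisfying⁻ (isCandidateEdge? i)

  module Copy (D : Subset m) (copy : KCopy k r (subgraph D)) where

    φ : Fin k → Fin r → Fin n
    φ = proj₁ copy

    φ-injective : ∀ i j a b → φ i a ≡ φ j b → (i ≡ j) × (a ≡ b)
    φ-injective = proj₁ (proj₂ copy)

    transversal-spec : ∀ g → ∃[ p ] (p ∈ D × edge p ≡ image (λ i → φ i (g i)))
    transversal-spec g with proj₂ (proj₂ copy) g
    ... | e , e∈ , e-spec with ∈-subgraph⁻ e∈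
    ... | p , p∈D , refl = p , p∈D , ⊆-antisym
          (λ x∈ → let i , eq = proj₁ (e-spec _) x∈ in subst (_∈ image φg) eq (∈-image⁺ φg i))
          (λ x∈ → proj₂ (e-spec _) (∈-image⁻ φg x∈))
      where
      φg : Fin k → Fin n
      φg i = φ i (g i)

    transversal : (Fin k → Fin r) → Fin m
    transversal g = proj₁ (transversal-spec g)

    transversal-∈ : ∀ g → transversal g ∈ D
    transversal-∈ g = proj₁ (proj₂ (transversal-spec g))

    edge-transversal : ∀ g → edge (transversal g) ≡ image (λ i → φ i (g i))
    edge-transversal g = proj₂ (proj₂ (transversal-spec g))

    transversal-injective : ∀ g h → transversal g ≡ transversal h → ∀ i → g i ≡ h i
    transversal-injective g h eq i
      with ∈-image⁻ (λ i → φ i (h i))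
             (subst (φ i (g i) ∈_) (trans (sym (edge-transversal g)) (trans (cong edge eq) (edge-transversal h)))
                    (∈-image⁺ (λ i → φ i (g i)) i))
    ... | i′ , eq′ with φ-injective i′ i (h i′) (g i) eq′
    ... | refl , hi≡gi = sym hi≡gi

    r^k≤∣D∣ : r ^ k ≤ ∣ D ∣
    r^k≤∣D∣ = injective⇒≤∣∣ D (transversal ∘ finToFun)
      (λ eq → finToFun-injective (transversal-injective _ _ eq))
      (transversal-∈ ∘ finToFun)

    diagonalEdge : Fin r → Fin m
    diagonalEdge j = transversal (λ _ → j)

    E : Fin r → Subset n
    E j = edge (diagonalEdge j)

    φ-∈-E : ∀ i j → φ i j ∈ E j
    φ-∈-E i j = subst (φ i j ∈_) (sym (edge-transversal (λ _ → j))) (∈-image⁺ (λ i → φ i j) i)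

    vertexE : ∀ j → Fin k → Fin n
    vertexE j = vertex (E j) (∣edge∣ (diagonalEdge j))

    vertexE-∈ : ∀ j a → vertexE j a ∈ E j
    vertexE-∈ j = vertex-∈ (E j) (∣edge∣ (diagonalEdge j))

    vertexE-injective : ∀ j → Injective _≡_ _≡_ (vertexE j)
    vertexE-injective j = vertex-injective (E j) (∣edge∣ (diagonalEdge j))

    vertexE-surjective : ∀ j {x} → x ∈ E j → ∃[ a ] vertexE j a ≡ x
    vertexE-surjective j = vertex-surjective (E j) (∣edge∣ (diagonalEdge j))

    π-spec : ∀ a → ∃[ i ] φ i zero ≡ vertexE zero a
    π-spec a = ∈-image⁻ (λ i → φ i zero)
      (subst (vertexE zero a ∈_) (edge-transversal (λ _ → zero)) (vertexE-∈ zero a))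

    π : Fin k → Fin k
    π a = proj₁ (π-spec a)

    π-injective : Injective _≡_ _≡_ π
    π-injective {a} {b} eq = vertexE-injective zero
      (trans (sym (proj₂ (π-spec a))) (trans (cong (λ i → φ i zero) eq) (proj₂ (π-spec b))))

    π⁻¹ : Fin k → Fin k
    π⁻¹ i = proj₁ (vertexE-surjective zero (φ-∈-E i zero))

    π∘π⁻¹ : ∀ i → π (π⁻¹ i) ≡ i
    π∘π⁻¹ i = proj₁ (φ-injective _ _ _ _
      (trans (proj₂ (π-spec (π⁻¹ i))) (proj₂ (vertexE-surjective zero (φ-∈-E i zero)))))

    π⁻¹∘π : ∀ a → π⁻¹ (π a) ≡ a
    π⁻¹∘π a = π-injective (π∘π⁻¹ (π a))

    σ-spec : ∀ j a → ∃[ b ] vertexE (suc j) b ≡ φ (π a) (suc j)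
    σ-spec j a = vertexE-surjective (suc j) (φ-∈-E (π a) (suc j))

    σ : Fin r′ → Fin k → Fin k
    σ j a = proj₁ (σ-spec j a)

    σ-injective : ∀ j → Injective _≡_ _≡_ (σ j)
    σ-injective j {a} {b} eq = π-injective (proj₁ (φ-injective _ _ _ _
      (trans (sym (proj₂ (σ-spec j a))) (trans (cong (vertexE (suc j)) eq) (proj₂ (σ-spec j b))))))

    σ-code : Fin r′ → Fin (k !)
    σ-code j = proj₁ (decodePerm-surjective k (σ j) (σ-injective j))

    i₀-spec : ∃[ i ] ((∀ j → diagonal i j ≡ diagonalEdge j) × (∀ j → matching i j ≡ σ-code j))
    i₀-spec = candidate-surjective diagonalEdge σ-code

    i₀ : Fin candidates
    i₀ = proj₁ i₀-spec

    candidateVertex-i₀ : ∀ a j → candidateVertex i₀ a j ≡ φ (π a) j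
    candidateVertex-i₀ a zero = trans
      (cong (λ p → vertex (edge p) (∣edge∣ p) a) (proj₁ (proj₂ i₀-spec) zero))
      (sym (proj₂ (π-spec a)))
    candidateVertex-i₀ a (suc j) = begin
      candidateVertex i₀ a (suc j)
        ≡⟨ cong₂ (λ p c → vertex (edge p) (∣edge∣ p) (decodePerm k c a))
                 (proj₁ (proj₂ i₀-spec) (suc j)) (proj₂ (proj₂ i₀-spec) j) ⟩
      vertexE (suc j) (decodePerm k _ a)
        ≡⟨ cong (vertexE (suc j)) (proj₂ (decodePerm-surjective k (σ j) (σ-injective j)) a) ⟩
      vertexE (suc j) (σ j a) ≡⟨ proj₂ (σ-spec j a) ⟩
      φ (π a) (suc j) ∎
      where open ≡-Reasoning

    image-candidate-i₀ : ∀ (g : Fin k → Fin r) →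
                         image (λ a → candidateVertex i₀ a (g a)) ≡ image (λ i → φ i (g (π⁻¹ i)))
    image-candidate-i₀ g = trans
      (image-cong {f = λ a → candidateVertex i₀ a (g a)} (λ a → candidateVertex-i₀ a (g a)))
      (image-≡ (λ a → φ (π a) (g a)) (λ i → φ i (g (π⁻¹ i)))
        (λ a → π a , cong (λ b → φ (π a) (g b)) (π⁻¹∘π a))
        (λ i → π⁻¹ i , cong (λ j → φ j (g (π⁻¹ i))) (π∘π⁻¹ i)))

    candidateEdges-⊆ : candidateEdges i₀ ⊆ D
    candidateEdges-⊆ {p} p∈ = subst (_∈ D) (sym p≡) (transversal-∈ g)
      where
      u : Fin (r ^ k)
      u = proj₁ (∈-candidateEdges⁻ p∈)
      edge-p : edge p ≡ image (λ a → candidateVertex i₀ a (finToFun u a))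
      edge-p = proj₂ (∈-candidateEdges⁻ p∈)
      g : Fin k → Fin r
      g i = finToFun u (π⁻¹ i)
      p≡ : p ≡ transversal g
      p≡ = lookup-injective G-unique
             (trans edge-p (trans (image-candidate-i₀ (finToFun u)) (sym (edge-transversal g))))

    r^k≤∣candidateEdges∣ : r ^ k ≤ ∣ candidateEdges i₀ ∣
    r^k≤∣candidateEdges∣ = injective⇒≤∣∣ (candidateEdges i₀) edgeOf edgeOf-injective edgeOf-∈
      where
      relabel : Fin (r ^ k) → Fin k → Fin r
      relabel u i = finToFun u (π⁻¹ i)
      edgeOf : Fin (r ^ k) → Fin m
      edgeOf = transversal ∘ relabel
      edgeOf-injective : Injective _≡_ _≡_ edgeOf
      edgeOf-injective {u} {v} eq = finToFun-injective λ a →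
        subst (λ b → finToFun u b ≡ finToFun v b) (π⁻¹∘π a) (transversal-injective _ _ eq (π a))
      edgeOf-∈ : ∀ u → edgeOf u ∈ candidateEdges i₀
      edgeOf-∈ u = ∈-candidateEdges⁺
        (u , trans (edge-transversal (relabel u)) (sym (image-candidate-i₀ (finToFun u))))

  copy⇒large-candidate : ∀ D → KCopy k r (subgraph D) →
                         ∃[ i ] (r ^ k ≤ ∣ candidateEdges i ∣ × candidateEdges i ⊆ D)
  copy⇒large-candidate D copy = i₀ , r^k≤∣candidateEdges∣ , candidateEdges-⊆
    where open Copy D copy

  HasKFreeSubgraph : ℕ → Set
  HasKFreeSubgraph K = ∃[ H ] (Unique H × SubEdges H G × KFree k r H × K ≤ length H)

  subgraph-witness : ∀ {K} D → KFree k r (subgraph D) → K ≤ ∣ D ∣ → HasKFreeSubgraph K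
  subgraph-witness D free K≤∣D∣ =
    subgraph D , subgraph-unique D , subgraph-⊆ D , free , subst (_ ≤_) (sym (length-subgraph D)) K≤∣D∣

  small-subgraph : ∀ K → K ≤ m → K < r ^ k → HasKFreeSubgraph K
  small-subgraph K K≤m K<r^k = let D , ∣D∣≡K = subset-of-size m K K≤m in
    subgraph-witness D (λ copy → <⇒≱ (subst (_< r ^ k) (sym ∣D∣≡K) K<r^k) (Copy.r^k≤∣D∣ D copy))
                       (≤-reflexive (sym ∣D∣≡K))

  altered-subgraph : ∀ a z K → 0 < a + z → AlterationBound a z m candidates (r ^ k) K →
                     HasKFreeSubgraph K
  altered-subgraph a z K a+z>0 bound =
    let D , K≤∣D∣ , D-avoids = alteration a z (r ^ k) candidateEdges a+z>0 K (m^n>0 r k) bound in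
    subgraph-witness D (λ copy → let i , large , ⊆D = copy⇒large-candidate D copy in D-avoids i large ⊆D)
                       K≤∣D∣

  HasKFreeSubgraph⇒bound : ∀ g K → m ^ g ≤ (2 * k ! * K) ^ suc g → HasKFreeSubgraph K →
    ∃[ H ] (Unique H × SubEdges H G × KFree k r H × m ^ g ≤ (2 * k ! * length H) ^ suc g)
  HasKFreeSubgraph⇒bound g K m^g≤ (H , H-unique , H⊆G , H-free , K≤∣H∣) =
    H , H-unique , H⊆G , H-free , ≤-trans m^g≤ (^-monoˡ-≤ (suc g) (*-monoʳ-≤ (2 * k !) K≤∣H∣))

-- Choice of the parameters

Minimal : (ℕ → Set) → ℕ → Set
Minimal P y = P y × ∀ {x} → x < y → ¬ P x

module _ {P : ℕ → Set} (P? : Decidable P) where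

  private
    search : ∀ i d → (∀ {x} → x < i → ¬ P x) → P (d + i) → ∃[ y ] (Minimal P y × y ≤ d + i)
    search i d below p with P? i
    search i d       below p | yes pi = i , (pi , below) , m≤n+m i d
    search i zero    below p | no ¬pi = contradiction p ¬pi
    search i (suc d) below p | no ¬pi =
      let y , min , y≤ = search (suc i) d below′ (subst P (sym (+-suc d i)) p) in
      y , min , subst (y ≤_) (+-suc d i) y≤
      where
      below′ : ∀ {x} → x < suc i → ¬ P x
      below′ x<1+i with m≤n⇒m<n∨m≡n x<1+i
      ... | inj₁ x<i  = below (≤-pred x<i)
      ... | inj₂ refl = ¬pi

  minimal : ∀ B → P B → ∃[ y ] (Minimal P y × y ≤ B)
  minimal B p = let y , min , y≤ = search 0 B (λ ()) (subst P (sym (+-identityʳ B)) p) in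
    y , min , subst (y ≤_) (+-identityʳ B) y≤

bernoulli : ∀ x v u → v + u ≡ suc x → suc x ^ v * u ≤ suc x * x ^ v
bernoulli x zero    u refl = ≤-reflexive (*-comm 1 (suc x))
bernoulli x (suc v) u v+u≡ = begin
  suc x ^ suc v * u         ≡⟨ *-assoc (suc x) (suc x ^ v) u ⟩
  suc x * (suc x ^ v * u)   ≡⟨ x∙yz≈y∙xz (suc x) (suc x ^ v) u ⟩
  suc x ^ v * (suc x * u)   ≤⟨ *-monoʳ-≤ (suc x ^ v) (1+x*u≤x*1+u u≤x) ⟩
  suc x ^ v * (x * suc u)   ≡⟨ x∙yz≈y∙xz (suc x ^ v) x (suc u) ⟩
  x * (suc x ^ v * suc u)   ≤⟨ *-monoʳ-≤ x (bernoulli x v (suc u) (trans (+-suc v u) v+u≡)) ⟩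
  x * (suc x * x ^ v)       ≡⟨ x∙yz≈y∙xz x (suc x) (x ^ v) ⟩
  suc x * x ^ suc v         ∎
  where
  open ≤-Reasoning
  u≤x : u ≤ x
  u≤x = subst (u ≤_) (suc-injective v+u≡) (m≤n+m u v)
  1+x*u≤x*1+u : ∀ {u} → u ≤ x → suc x * u ≤ x * suc u
  1+x*u≤x*1+u {u} u≤x = begin
    suc x * u   ≡⟨ +-comm u (x * u) ⟩
    x * u + u   ≤⟨ +-monoʳ-≤ (x * u) u≤x ⟩
    x * u + x   ≡⟨ sym (trans (*-suc x u) (+-comm x (x * u))) ⟩
    x * suc u   ∎

a*[d+w]≤[1+a]*w : ∀ a d w → a * d ≤ w → a * (d + w) ≤ suc a * w
a*[d+w]≤[1+a]*w a d w ad≤w = begin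
  a * (d + w)    ≡⟨ *-distribˡ-+ a d w ⟩
  a * d + a * w  ≤⟨ +-monoˡ-≤ (a * w) ad≤w ⟩
  w + a * w      ∎
  where open ≤-Reasoning

power-bound : ∀ x v w u → v + u ≡ suc x → 2 * suc x ≤ 3 * w → 3 * suc x ≤ 4 * u →
              suc x ^ suc v ≤ 2 * w * x ^ v
power-bound x v w u v+u≡ 2y≤3w 3y≤4u = *-cancelʳ-≤ _ _ y (begin
  y * y ^ v * y        ≡⟨ xy∙z≈xz∙y y (y ^ v) y ⟩
  y * y * y ^ v        ≤⟨ *-monoˡ-≤ (y ^ v) y²≤2wu ⟩
  2 * w * u * y ^ v    ≡⟨ xy∙z≈x∙zy (2 * w) u (y ^ v) ⟩
  2 * w * (y ^ v * u)  ≤⟨ *-monoʳ-≤ (2 * w) (bernoulli x v u v+u≡) ⟩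
  2 * w * (y * x ^ v)  ≡⟨ x∙yz≈xz∙y (2 * w) y (x ^ v) ⟩
  2 * w * x ^ v * y    ∎)
  where
  open ≤-Reasoning
  y = suc x
  6y²≡2y*3y : ∀ y → 6 * (y * y) ≡ (2 * y) * (3 * y)
  6y²≡2y*3y = solve-∀
  3w*4u≡6*2wu : ∀ w u → (3 * w) * (4 * u) ≡ 6 * (2 * w * u)
  3w*4u≡6*2wu = solve-∀
  y²≤2wu : y * y ≤ 2 * w * u
  y²≤2wu = *-cancelˡ-≤ 6 (begin
    6 * (y * y)        ≡⟨ 6y²≡2y*3y y ⟩
    (2 * y) * (3 * y)  ≤⟨ *-mono-≤ 2y≤3w 3y≤4u ⟩
    (3 * w) * (4 * u)  ≡⟨ 3w*4u≡6*2wu w u ⟩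
    6 * (2 * w * u)    ∎)

counting-inequality : ∀ F y w K A B C → 2 * F + w ≡ y → 2 * F * K ≤ y + 2 * F → 2 * C ≤ A * w * B →
                      K * F * A * B + C ≤ y * A * B
counting-inequality F y w K A B C 2F+w≡y 2FK≤ 2C≤ = *-cancelˡ-≤ 2 (begin
  2 * (K * F * A * B + C)          ≡⟨ expand K F A B C ⟩
  (2 * F * K) * (A * B) + 2 * C    ≤⟨ +-mono-≤ (*-monoˡ-≤ (A * B) 2FK≤) 2C≤ ⟩
  (y + 2 * F) * (A * B) + A * w * B ≡⟨ collect y F w A B ⟩
  (y + (2 * F + w)) * (A * B)       ≡⟨ cong (λ s → (y + s) * (A * B)) 2F+w≡y ⟩
  (y + y) * (A * B)                 ≡⟨ double y A B ⟩
  2 * (y * A * B)                   ∎)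
  where
  open ≤-Reasoning
  expand : ∀ K F A B C → 2 * (K * F * A * B + C) ≡ (2 * F * K) * (A * B) + 2 * C
  expand = solve-∀
  collect : ∀ y F w A B → (y + 2 * F) * (A * B) + A * w * B ≡ (y + (2 * F + w)) * (A * B)
  collect = solve-∀
  double : ∀ y A B → (y + y) * (A * B) ≡ 2 * (y * A * B)
  double = solve-∀

^-distribʳ-* : ∀ a b n → (a * b) ^ n ≡ a ^ n * b ^ n
^-distribʳ-* a b zero    = refl
^-distribʳ-* a b (suc n) =
  trans (cong (a * b *_) (^-distribʳ-* a b n)) ([m*n]*[o*p]≡[m*o]*[n*p] a b (a ^ n) (b ^ n))

-- Multiplying by F ^ r′ * m ^ r′ * F * m * m turns the inequality of counting-inequality
-- (with A = F ^ e, B = m ^ e, C = y ^ t) into the hypothesis of the alteration lemma for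
-- a = y, a + z = F * m, and m ^ r * F ^ r′ candidates.
rescale : ∀ m F y K r′ e →
  K * F * F ^ e * m ^ e + y ^ (suc r′ + e) ≤ y * F ^ e * m ^ e →
  K * ((F * m) ^ (suc r′ + e) * (F * m)) + m ^ suc r′ * F ^ r′ * y ^ (suc r′ + e) * (F * m)
    ≤ y * m * (F * m) ^ (suc r′ + e)
rescale m F y K r′ e ineq = begin
  K * ((F * m) ^ t * (F * m)) + m ^ suc r′ * F ^ r′ * y ^ t * (F * m)
    ≡⟨ cong (λ s → K * (s * (F * m)) + m ^ suc r′ * F ^ r′ * y ^ t * (F * m)) expand ⟩
  K * ((F * F ^ r′ * F ^ e) * (m * m ^ r′ * m ^ e) * (F * m)) + m * m ^ r′ * F ^ r′ * y ^ t * (F * m)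
    ≡⟨ factor K F m (F ^ r′) (m ^ r′) (F ^ e) (m ^ e) (y ^ t) ⟩
  (F ^ r′ * m ^ r′ * F * m * m) * (K * F * F ^ e * m ^ e + y ^ t)
    ≤⟨ *-monoʳ-≤ (F ^ r′ * m ^ r′ * F * m * m) ineq ⟩
  (F ^ r′ * m ^ r′ * F * m * m) * (y * F ^ e * m ^ e)
    ≡⟨ unfactor y F m (F ^ r′) (m ^ r′) (F ^ e) (m ^ e) ⟩
  y * m * ((F * F ^ r′ * F ^ e) * (m * m ^ r′ * m ^ e))
    ≡⟨ cong (y * m *_) expand ⟨
  y * m * (F * m) ^ t ∎
  where
  open ≤-Reasoning
  t = suc r′ + e
  expand : (F * m) ^ t ≡ (F * F ^ r′ * F ^ e) * (m * m ^ r′ * m ^ e)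
  expand = trans (^-distribʳ-* F m t)
                 (cong₂ _*_ (^-distribˡ-+-* F (suc r′) e) (^-distribˡ-+-* m (suc r′) e))
  factor : ∀ K F m Fr mr Fe me Y →
           K * ((F * Fr * Fe) * (m * mr * me) * (F * m)) + m * mr * Fr * Y * (F * m)
             ≡ (Fr * mr * F * m * m) * (K * F * Fe * me + Y)
  factor = solve-∀
  unfactor : ∀ y F m Fr mr Fe me →
             (Fr * mr * F * m * m) * (y * Fe * me) ≡ y * m * ((F * Fr * Fe) * (m * mr * me))
  unfactor = solve-∀

-- Here y = x + 1 is the least integer with m ^ g ≤ y ^ (g + 1), K′ + 1 is the least K
-- with y ≤ 2 F K, and edges are kept with probability y / (F m).
module LargeCase (m F r′ g x K′ : ℕ) (2≤F : 2 ≤ F) (1≤r′ : 1 ≤ r′) (2≤g : 2 ≤ g)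
                 (x^q≤m^g : x ^ suc g ≤ m ^ g) (y≤m : suc x ≤ m)
                 (2FK′≤x : 2 * F * K′ ≤ x) (v≤K′ : suc g * r′ ≤ K′) where

  private
    F>0 : 0 < F
    F>0 = ≤-trans (s≤s z≤n) 2≤F

    y = suc x
    v = suc g * r′
    e = g * r′
    w = y ∸ 2 * F
    u = y ∸ v

    2Fv≤x : 2 * F * v ≤ x
    2Fv≤x = ≤-trans (*-monoʳ-≤ (2 * F) v≤K′) 2FK′≤x

    3≤v : 3 ≤ v
    3≤v = ≤-trans (s≤s 2≤g) (m≤m*n (suc g) r′ {{>-nonZero 1≤r′}})

    2F+w≡y : 2 * F + w ≡ y
    2F+w≡y = m+[n∸m]≡n (≤-trans (m≤m*n (2 * F) v {{>-nonZero (≤-trans (s≤s z≤n) 3≤v)}}) (m≤n⇒m≤1+n 2Fv≤x))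

    v+u≡y : v + u ≡ y
    v+u≡y = m+[n∸m]≡n (≤-trans (m≤n*m v (2 * F) {{>-nonZero (≤-trans F>0 (m≤m+n F _))}}) (m≤n⇒m≤1+n 2Fv≤x))

    2y≤3w : 2 * y ≤ 3 * w
    2y≤3w = subst (λ s → 2 * s ≤ 3 * w) 2F+w≡y
                  (a*[d+w]≤[1+a]*w 2 (2 * F) w (+-cancelˡ-≤ (2 * F) _ _ (begin
      2 * F + 2 * (2 * F) ≡⟨ 2F+2[2F]≡2F*3 F ⟩
      2 * F * 3           ≤⟨ *-monoʳ-≤ (2 * F) 3≤v ⟩
      2 * F * v           ≤⟨ m≤n⇒m≤1+n 2Fv≤x ⟩
      y                   ≡⟨ 2F+w≡y ⟨
      2 * F + w           ∎)))
      where
      open ≤-Reasoning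
      2F+2[2F]≡2F*3 : ∀ F → 2 * F + 2 * (2 * F) ≡ 2 * F * 3
      2F+2[2F]≡2F*3 = solve-∀

    3y≤4u : 3 * y ≤ 4 * u
    3y≤4u = subst (λ s → 3 * s ≤ 4 * u) v+u≡y
                  (a*[d+w]≤[1+a]*w 3 v u (+-cancelˡ-≤ v _ _ (begin
      v + 3 * v    ≡⟨ v+3v≡2*2*v v ⟩
      2 * 2 * v    ≤⟨ *-monoˡ-≤ v (*-monoʳ-≤ 2 2≤F) ⟩
      2 * F * v    ≤⟨ m≤n⇒m≤1+n 2Fv≤x ⟩
      y            ≡⟨ v+u≡y ⟨
      v + u        ∎)))
      where
      open ≤-Reasoning
      v+3v≡2*2*v : ∀ v → v + 3 * v ≡ 2 * 2 * v
      v+3v≡2*2*v = solve-∀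

    2≤e : 2 ≤ e
    2≤e = ≤-trans 2≤g (m≤m*n g r′ {{>-nonZero 1≤r′}})

    4≤F^e : 4 ≤ F ^ e
    4≤F^e = ≤-trans (^-monoʳ-≤ 2 2≤e) (^-monoˡ-≤ e 2≤F)

    x^v≤m^e : x ^ v ≤ m ^ e
    x^v≤m^e = subst₂ _≤_ (^-*-assoc x (suc g) r′) (^-*-assoc m g r′) (^-monoˡ-≤ r′ x^q≤m^g)

    2y^[1+v]≤F^e*w*m^e : 2 * y ^ suc v ≤ F ^ e * w * m ^ e
    2y^[1+v]≤F^e*w*m^e = begin
      2 * y ^ suc v        ≤⟨ *-monoʳ-≤ 2 (power-bound x v w u v+u≡y 2y≤3w 3y≤4u) ⟩
      2 * (2 * w * x ^ v)  ≡⟨ 2[2wP]≡4wP w (x ^ v) ⟩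
      4 * w * x ^ v        ≤⟨ *-mono-≤ (*-monoˡ-≤ w 4≤F^e) x^v≤m^e ⟩
      F ^ e * w * m ^ e    ∎
      where
      open ≤-Reasoning
      2[2wP]≡4wP : ∀ w P → 2 * (2 * w * P) ≡ 4 * w * P
      2[2wP]≡4wP = solve-∀

    2FK≤y+2F : 2 * F * suc K′ ≤ y + 2 * F
    2FK≤y+2F = begin
      2 * F * suc K′     ≡⟨ *-suc (2 * F) K′ ⟩
      2 * F + 2 * F * K′ ≤⟨ +-monoʳ-≤ (2 * F) (m≤n⇒m≤1+n 2FK′≤x) ⟩
      2 * F + y          ≡⟨ +-comm (2 * F) y ⟩
      y + 2 * F          ∎
      where open ≤-Reasoning

    y+[Fm∸y]≡Fm : y + (F * m ∸ y) ≡ F * m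
    y+[Fm∸y]≡Fm = m+[n∸m]≡n (≤-trans y≤m (m≤n*m m F {{>-nonZero F>0}}))

  alteration-bound : AlterationBound y (F * m ∸ y) m (m ^ suc r′ * F ^ r′) (suc v) (suc K′)
  alteration-bound =
    subst (λ M → suc K′ * (M ^ suc v * M) + m ^ suc r′ * F ^ r′ * y ^ suc v * M ≤ y * m * M ^ suc v)
          (sym y+[Fm∸y]≡Fm)
          (rescale m F y (suc K′) r′ e
            (counting-inequality F y w (suc K′) (F ^ e) (m ^ e) (y ^ suc v)
                                 2F+w≡y 2FK≤y+2F 2y^[1+v]≤F^e*w*m^e))

m^n≤m^[1+n] : ∀ m n → 1 ≤ n → m ^ n ≤ m ^ suc n
m^n≤m^[1+n] zero    (suc n) _ = z≤n
m^n≤m^[1+n] (suc m) n       _ = m≤n*m (suc m ^ n) (suc m)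

large-K⇒alteration-bound : ∀ m F r′ g y K → 2 ≤ F → 1 ≤ r′ → 2 ≤ g →
  (∀ {x} → x < y → ¬ m ^ g ≤ x ^ suc g) → y ≤ m → (∀ {K′} → K′ < K → ¬ y ≤ 2 * F * K′) →
  suc (suc g * r′) ≤ K →
  ∃[ a ] ∃[ z ] (0 < a + z × AlterationBound a z m (m ^ suc r′ * F ^ r′) (suc (suc g * r′)) K)
large-K⇒alteration-bound m F r′ g zero    (suc K′) _ _ _ _ _ K-min _ = contradiction z≤n (K-min ≤-refl)
large-K⇒alteration-bound m F r′ g (suc x) (suc K′) 2≤F 1≤r′ 2≤g y-min y≤m K-min (s≤s v≤K′) =
  suc x , F * m ∸ suc x , s≤s z≤n ,
  LargeCase.alteration-bound m F r′ g x K′ 2≤F 1≤r′ 2≤g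
    (<⇒≤ (≰⇒> (y-min ≤-refl))) y≤m (≤-pred (≰⇒> (K-min ≤-refl))) v≤K′

choose-K : ∀ m F r′ g → 2 ≤ F → 1 ≤ r′ → 2 ≤ g →
  ∃[ K ] (m ^ g ≤ (2 * F * K) ^ suc g ×
          (K ≤ m × K < suc (suc g * r′)
           ⊎ ∃[ a ] ∃[ z ] (0 < a + z × AlterationBound a z m (m ^ suc r′ * F ^ r′) (suc (suc g * r′)) K)))
choose-K m F r′ g 2≤F 1≤r′ 2≤g
  with minimal (λ y → m ^ g ≤? y ^ suc g) m (m^n≤m^[1+n] m g (≤-trans (s≤s z≤n) 2≤g))
... | y , (m^g≤y^q , y-minimal) , y≤m
  with minimal (λ K → y ≤? 2 * F * K) y (m≤n*m y (2 * F) {{>-nonZero (*-monoʳ-< 2 (≤-trans (s≤s z≤n) 2≤F))}})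
... | K , (y≤2FK , K-minimal) , K≤y
  with K <? suc (suc g * r′)
... | yes K<t = K , ≤-trans m^g≤y^q (^-monoˡ-≤ (suc g) y≤2FK) , inj₁ (≤-trans K≤y y≤m , K<t)
... | no K≮t  = K , ≤-trans m^g≤y^q (^-monoˡ-≤ (suc g) y≤2FK) ,
  inj₂ (large-K⇒alteration-bound m F r′ g y K 2≤F 1≤r′ 2≤g y-minimal y≤m K-minimal (≮⇒≥ K≮t))

geom-closed-form : ∀ k r′ → suc (geom k (suc r′) * r′) ≡ suc r′ ^ k
geom-closed-form zero    r′ = refl
geom-closed-form (suc k) r′ = begin
  suc ((suc r′ ^ k + geom k (suc r′)) * r′)        ≡⟨ distribute (suc r′ ^ k) (geom k (suc r′)) r′ ⟩
  suc r′ ^ k * r′ + suc (geom k (suc r′) * r′)     ≡⟨ cong (suc r′ ^ k * r′ +_) (geom-closed-form k r′) ⟩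
  suc r′ ^ k * r′ + suc r′ ^ k                     ≡⟨ collect (suc r′ ^ k) r′ ⟩
  suc r′ ^ suc k                                   ∎
  where
  open ≡-Reasoning
  distribute : ∀ P g r′ → suc ((P + g) * r′) ≡ P * r′ + suc (g * r′)
  distribute = solve-∀
  collect : ∀ P r′ → P * r′ + P ≡ suc r′ * P
  collect = solve-∀

3≤geom : ∀ k r → 2 ≤ k → 2 ≤ r → 3 ≤ geom k r
3≤geom (suc (suc k)) r _ 2≤r = +-mono-≤ {2} {_} {1}
  (≤-trans 2≤r (m≤m*n r (r ^ k) {{>-nonZero r^k>0}}))
  (≤-trans r^k>0 (m≤m+n (r ^ k) _))
  where
  r^k>0 : 0 < r ^ k
  r^k>0 = m^n>0 r {{>-nonZero (≤-trans (s≤s z≤n) 2≤r)}} k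
3≤geom (suc zero) r (s≤s ()) _

2≤n! : ∀ n → 2 ≤ n → 2 ≤ n !
2≤n! (suc n) 2≤1+n = *-mono-≤ 2≤1+n (1≤n! n)

theorem3p4 : (k r : ℕ) → 2 ≤ k → 2 ≤ r →
    (n : ℕ) (G : List (Subset n)) → Unique G → Uniform k G →
    ∃[ H ] (Unique H × SubEdges H G × KFree k r H ×
            length G ^ (geom k r ∸ 1) ≤ (2 * k ! * length H) ^ geom k r)
theorem3p4 k (suc r′) 2≤k 2≤r@(s≤s 1≤r′) n G G-unique G-uniform
  with geom k (suc r′) | 3≤geom k (suc r′) 2≤k 2≤r | geom-closed-form k r′
... | suc g | s≤s 2≤g | 1+qr′≡r^k
  with choose-K (length G) (k !) r′ g (2≤n! k 2≤k) 1≤r′ 2≤g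
... | K , m^g≤[2FK]^q , inj₁ (K≤m , K<t) =
  HasKFreeSubgraph⇒bound g K m^g≤[2FK]^q (small-subgraph K K≤m (subst (K <_) 1+qr′≡r^k K<t))
  where open Hypergraph k r′ G G-unique G-uniform
... | K , m^g≤[2FK]^q , inj₂ (a , z , a+z>0 , a,z-good) =
  HasKFreeSubgraph⇒bound g K m^g≤[2FK]^q
    (altered-subgraph a z K a+z>0 (subst (λ t → AlterationBound a z m candidates t K) 1+qr′≡r^k a,z-good))
  where open Hypergraph k r′ G G-unique G-uniform
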